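{- There exist residuated lattices $A$ that do not satisfy $\neg a\vee\neg\neg a=1$ for all $a\in A$, but whose reticulation $\mathcal{L}(A)$ is a pseudocomplemented lattice satisfying $l^{*}\vee l^{**}=1$ for all $l\in\mathcal{L}(A)$.
   Context: A residuated lattice is an algebra $(A,\vee,\wedge,\odot,\rightarrow,0,1)$ with $(A,\vee,\wedge,0,1)$ a bounded lattice, $(A,\odot,1)$ a commutative monoid and $a\le b\rightarrow c$ iff $a\odot b\le c$; $\neg a=a\rightarrow 0$ and $a^n$ is the $n$-fold $\odot$-power. $\mathcal{L}(A)$ is the reticulation of $A$: the (unique up to isomorphism) bounded distributive lattice with a map $\lambda:A\to\mathcal{L}(A)$ such that for all $a,b$: $\lambda(a\odot b)=\lambda(a)\wedge\lambda(b)$; $\lambda(a\vee b)=\lambda(a)\vee\lambda(b)$; $\lambda(0)=0,\lambda(1)=1$; $\lambda$ surjective; $\lambda(a)\le\lambda(b)$ iff $a^n\le b$ for some $n\ge1$. A distributive lattice $L$ with $0$ is pseudocomplemented iff every $l\in L$ has a pseudocomplement $l^{*}$, the greatest element $m$ with $l\wedge m=0$. -}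

module Defs where

open import Data.Nat using (ℕ; zero; suc)
open import Data.Product using (Σ; ∃; ∃-syntax; _×_)
open import Relation.Binary.PropositionalEquality using (_≡_)
open import Algebra.Core using (Op₂)
open import Algebra.Structures using (IsCommutativeMonoid)
open import Algebra.Lattice.Structures using (IsLattice; IsDistributiveLattice)

record ResiduatedLattice : Set₁ where
  infixr 6 _∨_
  infixr 7 _∧_
  infixr 7 _⊙_
  infixr 5 _⇒_
  field
    Carrier : Set
    _∨_ _∧_ _⊙_ _⇒_ : Op₂ Carrier
    𝟘 𝟙 : Carrier
    isLattice : IsLattice _≡_ _∨_ _∧_
    𝟘-least : ∀ a → 𝟘 ∧ a ≡ 𝟘
    𝟙-greatest : ∀ a → a ∧ 𝟙 ≡ a
    ⊙-isCommutativeMonoid : IsCommutativeMonoid _≡_ _⊙_ 𝟙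

  _≤_ : Carrier → Carrier → Set
  a ≤ b = a ∧ b ≡ a

  field
    residuation-⇒ : ∀ a b c → a ≤ (b ⇒ c) → (a ⊙ b) ≤ c
    residuation-⇐ : ∀ a b c → (a ⊙ b) ≤ c → a ≤ (b ⇒ c)

  ¬_ : Carrier → Carrier
  ¬ a = a ⇒ 𝟘

  _^_ : Carrier → ℕ → Carrier
  a ^ zero = 𝟙
  a ^ suc n = a ⊙ (a ^ n)

record BoundedDistributiveLattice : Set₁ where
  infixr 6 _∨_
  infixr 7 _∧_
  field
    Carrier : Set
    _∨_ _∧_ : Op₂ Carrier
    𝟘 𝟙 : Carrier
    isDistributiveLattice : IsDistributiveLattice _≡_ _∨_ _∧_
    𝟘-least : ∀ a → 𝟘 ∧ a ≡ 𝟘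
    𝟙-greatest : ∀ a → a ∧ 𝟙 ≡ a

  _≤_ : Carrier → Carrier → Set
  a ≤ b = a ∧ b ≡ a

  IsPseudocomplementOf : Carrier → Carrier → Set
  IsPseudocomplementOf m l = (l ∧ m ≡ 𝟘) × (∀ x → l ∧ x ≡ 𝟘 → x ≤ m)

  IsPseudocomplementation : (Carrier → Carrier) → Set
  IsPseudocomplementation star = ∀ l → IsPseudocomplementOf (star l) l

record IsReticulation (A : ResiduatedLattice) (L : BoundedDistributiveLattice)
       (λ' : ResiduatedLattice.Carrier A → BoundedDistributiveLattice.Carrier L) : Set where
  private
    module A = ResiduatedLattice A
    module L = BoundedDistributiveLattice L
  field
    pres-⊙ : ∀ a b → λ' (a A.⊙ b) ≡ λ' a L.∧ λ' b
    pres-∨ : ∀ a b → λ' (a A.∨ b) ≡ λ' a L.∨ λ' b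
    pres-𝟘 : λ' A.𝟘 ≡ L.𝟘
    pres-𝟙 : λ' A.𝟙 ≡ L.𝟙
    surjective : ∀ l → ∃[ a ] (λ' a ≡ l)
    order : ∀ a b → (λ' a L.≤ λ' b → ∃[ n ] ((a A.^ suc n) A.≤ b))
                  × (∃[ n ] ((a A.^ suc n) A.≤ b) → λ' a L.≤ λ' b)

-- The three-element MV-chain Ł₃ = {0, ½, 1} is a counterexample.  Its middle element is
-- nilpotent (½ ⊙ ½ = 0) and equals its own negation, so ¬ ½ ∨ ¬ ¬ ½ = ½ ≠ 1.  Collapsing the
-- nilpotent elements, the reticulation of Ł₃ is the two-element Boolean algebra, whose
-- complement is a pseudocomplement satisfying l* ∨ l** = 1.
module Submission where

open import Defs
open import Algebra.Structures using (IsCommutativeMonoid)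
open import Data.Bool using (Bool; true; false; not; _∧_; _∨_) renaming (_≟_ to _≟ᵇ_)
open import Data.Bool.Properties
  using (∨-∧-isDistributiveLattice; ∧-identityʳ; ∧-inverseʳ; ∨-inverseʳ)
open import Data.Nat using (zero; suc)
open import Data.Product using (Σ; ∃; ∃-syntax; _×_; _,_)
open import Function using (_∘_)
open import Relation.Binary.Definitions using (DecidableEquality)
open import Relation.Binary.PropositionalEquality
  using (_≡_; _≢_; refl; sym; trans; cong; cong₂; isEquivalence)
open import Relation.Nullary using (¬_; Dec; yes; no)
open import Relation.Nullary.Decidable using (from-yes; _→-dec_)

𝟙^n≡𝟙 : (A : ResiduatedLattice) → let open ResiduatedLattice A in ∀ n → 𝟙 ^ n ≡ 𝟙
𝟙^n≡𝟙 A zero    = refl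
𝟙^n≡𝟙 A (suc n) = trans (cong (𝟙 ⊙_) (𝟙^n≡𝟙 A n)) (identityˡ 𝟙)
  where
  open ResiduatedLattice A
  open IsCommutativeMonoid ⊙-isCommutativeMonoid using (identityˡ)

𝔹 : BoundedDistributiveLattice
𝔹 = record
  { Carrier = Bool ; _∨_ = _∨_ ; _∧_ = _∧_ ; 𝟘 = false ; 𝟙 = true
  ; isDistributiveLattice = ∨-∧-isDistributiveLattice
  ; 𝟘-least = λ _ → refl ; 𝟙-greatest = ∧-identityʳ }

not-isPseudocomplementation : BoundedDistributiveLattice.IsPseudocomplementation 𝔹 not
not-isPseudocomplementation l = ∧-inverseʳ l , maximal l
  where
  maximal : ∀ l x → l ∧ x ≡ false → x ∧ not l ≡ x
  maximal true  false _ = refl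
  maximal false x     _ = ∧-identityʳ x

data Ł₃ : Set where
  𝟎 ½ 𝟏 : Ł₃

infixr 6 _⊔_
infixr 7 _⊓_ _⊙_
infixr 5 _⇒_

_⊔_ _⊓_ _⊙_ _⇒_ : Ł₃ → Ł₃ → Ł₃
𝟎 ⊔ y = y
𝟏 ⊔ _ = 𝟏
½ ⊔ 𝟎 = ½
½ ⊔ y = y

𝟎 ⊓ _ = 𝟎
𝟏 ⊓ y = y
½ ⊓ 𝟏 = ½
½ ⊓ y = y

𝟎 ⊙ _ = 𝟎
𝟏 ⊙ y = y
½ ⊙ 𝟏 = ½
½ ⊙ _ = 𝟎

𝟎 ⇒ _ = 𝟏
𝟏 ⇒ y = y
½ ⇒ 𝟎 = ½
½ ⇒ _ = 𝟏

infix 4 _≟_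

_≟_ : DecidableEquality Ł₃
𝟎 ≟ 𝟎 = yes refl
½ ≟ ½ = yes refl
𝟏 ≟ 𝟏 = yes refl
𝟎 ≟ ½ = no λ ()
𝟎 ≟ 𝟏 = no λ ()
½ ≟ 𝟎 = no λ ()
½ ≟ 𝟏 = no λ ()
𝟏 ≟ 𝟎 = no λ ()
𝟏 ≟ ½ = no λ ()

∀? : {P : Ł₃ → Set} → (∀ x → Dec (P x)) → Dec (∀ x → P x)
∀? P? with P? 𝟎 | P? ½ | P? 𝟏
... | yes p₀ | yes p½ | yes p₁ = yes λ { 𝟎 → p₀ ; ½ → p½ ; 𝟏 → p₁ }
... | no ¬p₀ | _      | _      = no λ p → ¬p₀ (p 𝟎)
... | yes _  | no ¬p½ | _      = no λ p → ¬p½ (p ½)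
... | yes _  | yes _  | no ¬p₁ = no λ p → ¬p₁ (p 𝟏)

Ł₃-residuatedLattice : ResiduatedLattice
Ł₃-residuatedLattice = record
  { Carrier = Ł₃ ; _∨_ = _⊔_ ; _∧_ = _⊓_ ; _⊙_ = _⊙_ ; _⇒_ = _⇒_ ; 𝟘 = 𝟎 ; 𝟙 = 𝟏
  ; isLattice = record
    { isEquivalence = isEquivalence
    ; ∨-comm  = from-yes (∀? λ x → ∀? λ y → x ⊔ y ≟ y ⊔ x)
    ; ∨-assoc = from-yes (∀? λ x → ∀? λ y → ∀? λ z → (x ⊔ y) ⊔ z ≟ x ⊔ (y ⊔ z))
    ; ∨-cong  = cong₂ _⊔_
    ; ∧-comm  = from-yes (∀? λ x → ∀? λ y → x ⊓ y ≟ y ⊓ x)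
    ; ∧-assoc = from-yes (∀? λ x → ∀? λ y → ∀? λ z → (x ⊓ y) ⊓ z ≟ x ⊓ (y ⊓ z))
    ; ∧-cong  = cong₂ _⊓_
    ; absorptive = from-yes (∀? λ x → ∀? λ y → x ⊔ (x ⊓ y) ≟ x)
                 , from-yes (∀? λ x → ∀? λ y → x ⊓ (x ⊔ y) ≟ x) }
  ; 𝟘-least = λ _ → refl
  ; 𝟙-greatest = from-yes (∀? λ x → x ⊓ 𝟏 ≟ x)
  ; ⊙-isCommutativeMonoid = record
    { isMonoid = record
      { isSemigroup = record
        { isMagma = record { isEquivalence = isEquivalence ; ∙-cong = cong₂ _⊙_ }
        ; assoc = from-yes (∀? λ x → ∀? λ y → ∀? λ z → (x ⊙ y) ⊙ z ≟ x ⊙ (y ⊙ z)) }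
      ; identity = (λ _ → refl) , from-yes (∀? λ x → x ⊙ 𝟏 ≟ x) }
    ; comm = from-yes (∀? λ x → ∀? λ y → x ⊙ y ≟ y ⊙ x) }
  ; residuation-⇒ = from-yes (∀? λ a → ∀? λ b → ∀? λ c →
                      (a ⊓ (b ⇒ c) ≟ a) →-dec ((a ⊙ b) ⊓ c ≟ a ⊙ b))
  ; residuation-⇐ = from-yes (∀? λ a → ∀? λ b → ∀? λ c →
                      ((a ⊙ b) ⊓ c ≟ a ⊙ b) →-dec (a ⊓ (b ⇒ c) ≟ a)) }

open ResiduatedLattice Ł₃-residuatedLattice using (_^_; _≤_)

isOne : Ł₃ → Bool
isOne 𝟏 = true
isOne _ = false

isOne-true : ∀ {a} → isOne a ≡ true → a ≡ 𝟏
isOne-true {𝟏} _ = refl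

isOne-⊙ : ∀ a b → isOne (a ⊙ b) ≡ isOne a ∧ isOne b
isOne-⊙ = from-yes (∀? λ a → ∀? λ b → isOne (a ⊙ b) ≟ᵇ (isOne a ∧ isOne b))

isOne-⊔ : ∀ a b → isOne (a ⊔ b) ≡ isOne a ∨ isOne b
isOne-⊔ = from-yes (∀? λ a → ∀? λ b → isOne (a ⊔ b) ≟ᵇ (isOne a ∨ isOne b))

-- Below 𝟏 every element squares to 𝟎, while all powers of 𝟏 are 𝟏.
isOne-order : ∀ a b → (isOne a ∧ isOne b ≡ isOne a → ∃[ n ] ((a ^ suc n) ≤ b))
                    × (∃[ n ] ((a ^ suc n) ≤ b) → isOne a ∧ isOne b ≡ isOne a)
isOne-order 𝟎 b = (λ _ → 0 , refl) , (λ _ → refl)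
isOne-order ½ b = (λ _ → 1 , refl) , (λ _ → refl)
isOne-order 𝟏 b = (λ b≡𝟏 → 0 , cong (𝟏 ⊓_) (isOne-true b≡𝟏))
                , λ (n , 𝟏^n≤b) → cong isOne (powerOfOne≤ n 𝟏^n≤b)
  where
  powerOfOne≤ : ∀ n → (𝟏 ^ suc n) ≤ b → b ≡ 𝟏
  powerOfOne≤ n p rewrite 𝟙^n≡𝟙 Ł₃-residuatedLattice n = p

isOne-isReticulation : IsReticulation Ł₃-residuatedLattice 𝔹 isOne
isOne-isReticulation = record
  { pres-⊙ = isOne-⊙ ; pres-∨ = isOne-⊔ ; pres-𝟘 = refl ; pres-𝟙 = refl
  ; surjective = λ { true → 𝟏 , refl ; false → 𝟎 , refl }
  ; order = isOne-order }

¬½∨¬¬½≡½ : (½ ⇒ 𝟎) ⊔ ((½ ⇒ 𝟎) ⇒ 𝟎) ≡ ½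
¬½∨¬¬½≡½ = refl

mainTheorem17 : Σ ResiduatedLattice λ A → Σ BoundedDistributiveLattice λ L → Σ (ResiduatedLattice.Carrier A → BoundedDistributiveLattice.Carrier L) λ λ' → IsReticulation A L λ' × ¬ (∀ a → ResiduatedLattice._∨_ A (ResiduatedLattice.¬_ A a) (ResiduatedLattice.¬_ A (ResiduatedLattice.¬_ A a)) ≡ ResiduatedLattice.𝟙 A) × Σ (BoundedDistributiveLattice.Carrier L → BoundedDistributiveLattice.Carrier L) λ star → BoundedDistributiveLattice.IsPseudocomplementation L star × (∀ l → BoundedDistributiveLattice._∨_ L (star l) (star (star l)) ≡ BoundedDistributiveLattice.𝟙 L)
mainTheorem17 =
  Ł₃-residuatedLattice , 𝔹 , isOne , isOne-isReticulation
  , (λ law → ½≢𝟏 (trans (sym ¬½∨¬¬½≡½) (law ½)))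
  , not , not-isPseudocomplementation , ∨-inverseʳ ∘ not
  where
  ½≢𝟏 : ½ ≢ 𝟏
  ½≢𝟏 ()
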